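{- For all integers $n\ge 0$, \[ a_{4,1}(n)\ge a_{4,3}(n). \]
   Context: A partition of $n$ is a non-increasing sequence of positive integers summing to $n$; its Young diagram is the left-justified array of boxes whose $i$-th row has $\lambda_i$ boxes. The hook length of a box is the number of boxes directly to its right, plus the number directly below it, plus $1$; a box of hook length $k$ is a $k$-hook. For $t\ge 2$, a $t$-core partition is a partition none of whose hook lengths is divisible by $t$. $a_{t,k}(n)$ denotes the total number of hooks of length $k$ summed over all $t$-core partitions of $n$. -}

module Defs where

open import Data.Nat using (ℕ; zero; suc; _+_; _∸_; _≤ᵇ_; _<ᵇ_; _≡ᵇ_; _%_)
open import Data.Bool using (Bool; true; false; if_then_else_; not; _∧_; T?)
open import Data.List using (List; []; _∷_; _++_; map; concatMap; filter; upTo)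
open import Data.Nat.ListAction using (sum)

-- A partition is represented by its list of parts λ₁ ≥ λ₂ ≥ … ≥ λₗ > 0.

allB : {A : Set} → (A → Bool) → List A → Bool
allB p [] = true
allB p (x ∷ xs) = p x ∧ allB p xs

-- allLists n : every list of length ≤ n whose entries lie in {1,…,n}.
-- (Every partition of n is such a list, since it has at most n parts,
-- each between 1 and n.)
allLists : ℕ → List (List ℕ)
allLists n = go n
  where
  go : ℕ → List (List ℕ)
  go zero = [] ∷ []
  go (suc l) = [] ∷ concatMap (λ xs → map (λ i → suc i ∷ xs) (upTo n)) (go l)

nonIncreasing : List ℕ → Bool
nonIncreasing [] = true
nonIncreasing (x ∷ []) = true
nonIncreasing (x ∷ y ∷ ys) = (y ≤ᵇ x) ∧ nonIncreasing (y ∷ ys)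

isPartitionOf : ℕ → List ℕ → Bool
isPartitionOf n xs = allB (λ x → 1 ≤ᵇ x) xs ∧ nonIncreasing xs ∧ (sum xs ≡ᵇ n)

-- All partitions of n, each listed exactly once (allLists n has no
-- duplicates, and a partition is identified with its list of parts).
partitions : ℕ → List (List ℕ)
partitions n = filter (λ xs → T? (isPartitionOf n xs)) (allLists n)

countB : {A : Set} → (A → Bool) → List A → ℕ
countB p [] = 0
countB p (x ∷ xs) = if p x then suc (countB p xs) else countB p xs

-- The box in row i, column j (0-indexed, j < λᵢ) has
--   arm  = λᵢ ∸ j ∸ 1  (boxes to its right),
--   leg  = #{ rows below i whose length is > j } (boxes below it),
--   hook = arm + leg + 1.
hooks : List ℕ → List ℕ
hooks [] = []
hooks (r ∷ rs) =
  map (λ j → (r ∸ j ∸ 1) + countB (λ r' → j <ᵇ r') rs + 1) (upTo r) ++ hooks rs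

-- t-core: no hook length divisible by t  (t ≥ 2 is assumed by callers).
isCore : (t : ℕ) → .{{_ : Data.Nat.NonZero t}} → List ℕ → Bool
isCore t λ' = allB (λ h → not (h % t ≡ᵇ 0)) (hooks λ')

numHooks : ℕ → List ℕ → ℕ
numHooks k λ' = countB (λ h → h ≡ᵇ k) (hooks λ')

a : (t : ℕ) → .{{_ : Data.Nat.NonZero t}} → ℕ → ℕ → ℕ
a t k n = sum (map (numHooks k) (filter (λ λ' → T? (isCore t λ')) (partitions n)))

-- Write dᵢ = λᵢ₊₁ − λᵢ₊₂ for the gaps between consecutive parts. In the first row the box with
-- arm a has leg ℓ exactly when d₀ + ⋯ + d_{ℓ−1} ≤ a < d₀ + ⋯ + d_ℓ, and hook lengths strictly
-- decrease along a row. So the first row has a 1-hook iff d₀ > 0, and at most one 3-hook, which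
-- exists iff d₀ ≥ 3, or d₀ ≤ 1 < d₀ + d₁, or d₀ + d₁ = 0 < d₀ + d₁ + d₂; in a 4-core none of the
-- analogous 4-hook patterns occurs. Pair each 3-hook with the 1-hook ending the first row, at or
-- below its own, whose gap is nonzero: the excluded 4-hook patterns make this pairing injective.
-- Row by row this is an amortised count, whose potential records whether the 1-hook at the
-- first nonzero gap is still unpaired.
module Submission where

open import Defs
open import Data.Nat using (ℕ; _≥_)
open import Data.Nat
  using (zero; suc; _+_; _∸_; _%_; _≤_; _<_; _>_; _≤ᵇ_; _<ᵇ_; _≡ᵇ_; z≤n; s≤s; z<s; NonZero)
open import Data.Nat.Properties
open import Data.Nat.ListAction using (sum)
open import Data.Bool using (Bool; true; false; T; T?; not; _∧_; _∨_; if_then_else_)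
open import Data.Bool.Properties using (T-∧; T-≡)
open import Data.Unit using (tt)
open import Data.Empty using (⊥-elim)
open import Data.Product using (∃; ∃₂; _×_; _,_; proj₁; proj₂)
open import Data.Sum using (_⊎_; inj₁; inj₂)
open import Data.List using (List; []; _∷_; _++_; map; filter; upTo)
open import Data.List.Properties using (map-upTo)
open import Data.List.Membership.Propositional using (_∈_)
open import Data.List.Membership.Propositional.Properties
  using (∈-map⁺; ∈-map⁻; ∈-upTo⁺; ∈-upTo⁻; ∈-filter⁻)
open import Data.List.Relation.Unary.All as All using (All; []; _∷_)
open import Data.List.Relation.Unary.All.Properties using (++⁻)
open import Data.List.Relation.Unary.Any using (here; there)
open import Data.List.Relation.Unary.AllPairs as AllPairs using (AllPairs; []; _∷_)
open import Data.List.Relation.Unary.AllPairs.Properties using (applyUpTo⁺₁)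
open import Data.List.Relation.Unary.Linked as Linked using (Linked; []; [-]; _∷_)
open import Data.List.Relation.Unary.Unique.Propositional using (Unique)
open import Function using (_∘_; Equivalence)
open import Relation.Nullary using (¬_)
open import Relation.Binary.Definitions using (tri<; tri≈; tri>)
open import Relation.Binary.PropositionalEquality

open Equivalence using (to; from)

𝟙[_] : Bool → ℕ
𝟙[ b ] = if b then 1 else 0

𝟙-≤ : ∀ {b n} → (T b → 1 ≤ n) → 𝟙[ b ] ≤ n
𝟙-≤ {true} pos = pos tt
𝟙-≤ {false} _ = z≤n

≤1-pos⇒≤ : ∀ {m n} → m ≤ 1 → (1 ≤ m → 1 ≤ n) → m ≤ n
≤1-pos⇒≤ {zero} _ _ = z≤n
≤1-pos⇒≤ {suc zero} _ pos = pos ≤-refl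
≤1-pos⇒≤ {suc (suc _)} (s≤s ()) _

𝟙-pos₃ : ∀ x y z → T x ⊎ T y ⊎ T z → 1 ≤ 𝟙[ x ] + 𝟙[ y ] + 𝟙[ z ]
𝟙-pos₃ true _ _ _ = s≤s z≤n
𝟙-pos₃ false true _ _ = s≤s z≤n
𝟙-pos₃ false false true _ = s≤s z≤n
𝟙-pos₃ false false false (inj₁ ())
𝟙-pos₃ false false false (inj₂ (inj₁ ()))
𝟙-pos₃ false false false (inj₂ (inj₂ ()))

countB-++ : ∀ {A : Set} (p : A → Bool) xs ys →
  countB p (xs ++ ys) ≡ countB p xs + countB p ys
countB-++ p [] ys = refl
countB-++ p (x ∷ xs) ys with p x
... | true  = cong suc (countB-++ p xs ys)
... | false = countB-++ p xs ys

countB-mono : ∀ {A : Set} {p q : A → Bool} → (∀ {x} → T (p x) → T (q x)) →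
  ∀ xs → countB p xs ≤ countB q xs
countB-mono p⇒q [] = z≤n
countB-mono {p = p} {q} p⇒q (x ∷ xs) with p x in px | q x in qx
... | true  | true  = s≤s (countB-mono p⇒q xs)
... | true  | false = ⊥-elim (subst T qx (p⇒q (from T-≡ px)))
... | false | true  = m≤n⇒m≤1+n (countB-mono p⇒q xs)
... | false | false = countB-mono p⇒q xs

countB-none : ∀ {A : Set} {p : A → Bool} {xs} → All (λ x → ¬ T (p x)) xs → countB p xs ≡ 0
countB-none [] = refl
countB-none {p = p} {x ∷ _} (¬px ∷ rest) with p x
... | true  = ⊥-elim (¬px tt)
... | false = countB-none rest

∈⇒1≤countB : ∀ {A : Set} (p : A → Bool) {x xs} → x ∈ xs → T (p x) → 1 ≤ countB p xs
∈⇒1≤countB p {x} (here refl) px with p x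
... | true  = s≤s z≤n
... | false = ⊥-elim px
∈⇒1≤countB p {xs = y ∷ _} (there x∈) px with p y
... | true  = s≤s z≤n
... | false = ∈⇒1≤countB p x∈ px

1≤countB⇒∈ : ∀ {A : Set} (p : A → Bool) xs → 1 ≤ countB p xs → ∃ λ x → x ∈ xs × T (p x)
1≤countB⇒∈ p (x ∷ xs) pos with p x in px
... | true  = x , here refl , from T-≡ px
... | false with 1≤countB⇒∈ p xs pos
...   | y , y∈ , py = y , there y∈ , py

countB-unique : ∀ {k xs} → Unique xs → countB (_≡ᵇ k) xs ≤ 1
countB-unique [] = z≤n
countB-unique {k} {x ∷ xs} (x≢xs ∷ unique) with x ≡ᵇ k in x≡k
... | false = countB-unique unique
... | true  = s≤s (≤-reflexive (countB-none (All.map ≢k x≢xs)))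
  where
  ≢k : ∀ {y} → x ≢ y → ¬ T (y ≡ᵇ k)
  ≢k x≢y y≡k = x≢y (trans (≡ᵇ⇒≡ x k (from T-≡ x≡k)) (sym (≡ᵇ⇒≡ _ k y≡k)))

allB⇒All : ∀ {A : Set} (p : A → Bool) xs → T (allB p xs) → All (T ∘ p) xs
allB⇒All p [] _ = []
allB⇒All p (x ∷ xs) t = proj₁ (to T-∧ t) ∷ allB⇒All p xs (proj₂ (to T-∧ t))

All⇒allB : ∀ {A : Set} {p : A → Bool} {xs} → All (T ∘ p) xs → T (allB p xs)
All⇒allB [] = tt
All⇒allB (px ∷ rest) = from T-∧ (px , All⇒allB rest)

sum-map-mono : ∀ {A : Set} {f g : A → ℕ} xs → (∀ {x} → x ∈ xs → f x ≤ g x) →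
  sum (map f xs) ≤ sum (map g xs)
sum-map-mono [] _ = z≤n
sum-map-mono (x ∷ xs) f≤g = +-mono-≤ (f≤g (here refl)) (sum-map-mono xs (f≤g ∘ there))

-- part i xs is the (i+1)-st part, and 0 past the last one.
part : ℕ → List ℕ → ℕ
part _ [] = 0
part zero (x ∷ _) = x
part (suc i) (_ ∷ xs) = part i xs

gap : ℕ → List ℕ → ℕ
gap i xs = part i xs ∸ part (suc i) xs

shortfall : ℕ → List ℕ → ℕ
shortfall ℓ xs = part 0 xs ∸ part ℓ xs

NonIncreasing : List ℕ → Set
NonIncreasing = Linked _≥_

nonIncreasing⇒NonIncreasing : ∀ xs → T (nonIncreasing xs) → NonIncreasing xs
nonIncreasing⇒NonIncreasing [] _ = []
nonIncreasing⇒NonIncreasing (_ ∷ []) _ = [-]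
nonIncreasing⇒NonIncreasing (x ∷ y ∷ ys) t =
  ≤ᵇ⇒≤ y x (proj₁ (to T-∧ t)) ∷ nonIncreasing⇒NonIncreasing (y ∷ ys) (proj₂ (to T-∧ t))

isPartitionOf⇒NonIncreasing : ∀ {n} xs → T (isPartitionOf n xs) → NonIncreasing xs
isPartitionOf⇒NonIncreasing xs t =
  nonIncreasing⇒NonIncreasing xs (proj₁ (to T-∧ (proj₂ (to (T-∧ {x = allB _ xs}) t))))

part-suc-≤ : ∀ i {xs} → NonIncreasing xs → part (suc i) xs ≤ part i xs
part-suc-≤ _ [] = z≤n
part-suc-≤ zero [-] = z≤n
part-suc-≤ (suc _) [-] = z≤n
part-suc-≤ zero (y≤x ∷ _) = y≤x
part-suc-≤ (suc i) (_ ∷ ni) = part-suc-≤ i ni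

part-≤-head : ∀ k {xs} → NonIncreasing xs → part k xs ≤ part 0 xs
part-≤-head zero _ = ≤-refl
part-≤-head (suc k) {[]} _ = z≤n
part-≤-head (suc k) {_ ∷ _} ni = ≤-trans (part-≤-head k (Linked.tail ni)) (part-suc-≤ 0 ni)

part-antitone : ∀ {i k} xs → NonIncreasing xs → i ≤ k → part k xs ≤ part i xs
part-antitone [] _ _ = z≤n
part-antitone {k = k} (_ ∷ _) ni z≤n = part-≤-head k ni
part-antitone (_ ∷ xs) ni (s≤s i≤k) = part-antitone xs (Linked.tail ni) i≤k

m∸o≡[m∸n]+[n∸o] : ∀ {m n o} → n ≤ m → o ≤ n → m ∸ o ≡ (m ∸ n) + (n ∸ o)
m∸o≡[m∸n]+[n∸o] {m} {n} {o} n≤m o≤n = begin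
  m ∸ o             ≡⟨ cong (_∸ o) (sym (m∸n+n≡m n≤m)) ⟩
  (m ∸ n) + n ∸ o   ≡⟨ +-∸-assoc (m ∸ n) o≤n ⟩
  (m ∸ n) + (n ∸ o) ∎
  where open ≡-Reasoning

part-∸-split : ∀ {i j k} xs → NonIncreasing xs → i ≤ j → j ≤ k →
  part i xs ∸ part k xs ≡ (part i xs ∸ part j xs) + (part j xs ∸ part k xs)
part-∸-split xs ni i≤j j≤k = m∸o≡[m∸n]+[n∸o] (part-antitone xs ni i≤j) (part-antitone xs ni j≤k)

shortfall-mono : ∀ {ℓ ℓ′} xs → NonIncreasing xs → ℓ ≤ ℓ′ → shortfall ℓ xs ≤ shortfall ℓ′ xs
shortfall-mono xs ni ℓ≤ℓ′ = ∸-monoʳ-≤ (part 0 xs) (part-antitone xs ni ℓ≤ℓ′)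

leg : ℕ → List ℕ → ℕ
leg j rs = countB (j <ᵇ_) rs

leg-antitone : ∀ {j j′} rs → j ≤ j′ → leg j′ rs ≤ leg j rs
leg-antitone {j} {j′} rs j≤j′ =
  countB-mono (λ {x} j′<x → <⇒<ᵇ (≤-<-trans j≤j′ (<ᵇ⇒< j′ x j′<x))) rs

leg-≡0 : ∀ {j} ys → NonIncreasing ys → part 0 ys ≤ j → leg j ys ≡ 0
leg-≡0 [] _ _ = refl
leg-≡0 {j} (y ∷ ys) ni y≤j with j <ᵇ y in j<y
... | true  = ⊥-elim (<⇒≱ (<ᵇ⇒< j y (from T-≡ j<y)) y≤j)
... | false = leg-≡0 ys (Linked.tail ni) (≤-trans (part-suc-≤ 0 ni) y≤j)

leg-bounds : ∀ {j r} rs → NonIncreasing (r ∷ rs) → j < r →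
  part (suc (leg j rs)) (r ∷ rs) ≤ j × j < part (leg j rs) (r ∷ rs)
leg-bounds [] _ j<r = z≤n , j<r
leg-bounds {j} {r} (y ∷ ys) ni j<r with j <ᵇ y in j<ᵇy
... | true  = leg-bounds ys (Linked.tail ni) (<ᵇ⇒< j y (from T-≡ j<ᵇy))
... | false = subst (λ ℓ → part (suc ℓ) (r ∷ y ∷ ys) ≤ j × j < part ℓ (r ∷ y ∷ ys))
                (sym (leg-≡0 ys (Linked.tail (Linked.tail ni))
                  (≤-trans (part-suc-≤ 0 (Linked.tail ni)) y≤j)))
                (y≤j , j<r)
  where
  y≤j : y ≤ j
  y≤j = ≮⇒≥ (λ j<y → subst T j<ᵇy (<⇒<ᵇ j<y))

arm : ℕ → ℕ → ℕ
arm r j = r ∸ j ∸ 1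

arm≡ : ∀ r j → arm r j ≡ r ∸ suc j
arm≡ r j = trans (∸-+-assoc r j 1) (cong (r ∸_) (+-comm j 1))

hookLength : ℕ → List ℕ → ℕ → ℕ
hookLength r rs j = arm r j + leg j rs + 1

firstRowHooks : ℕ → List ℕ → List ℕ
firstRowHooks r rs = map (hookLength r rs) (upTo r)

firstRowHooks-unique : ∀ r rs → Unique (firstRowHooks r rs)
firstRowHooks-unique r rs =
  AllPairs.map >⇒≢ (subst (AllPairs _>_) (sym (map-upTo (hookLength r rs) r))
    (applyUpTo⁺₁ (hookLength r rs) r decreasing))
  where
  decreasing : ∀ {i j} → i < j → j < r → hookLength r rs i > hookLength r rs j
  decreasing {i} {j} i<j j<r = +-monoˡ-< 1 (+-mono-<-≤ arm-decreasing (leg-antitone rs (<⇒≤ i<j)))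
    where
    arm-decreasing : arm r j < arm r i
    arm-decreasing = subst₂ _<_ (sym (arm≡ r j)) (sym (arm≡ r i)) (∸-monoʳ-< (s≤s i<j) j<r)

-- The box of the first row with arm a, in column λ₁ − 1 − a, has leg ℓ: rows 2, …, ℓ + 1
-- reach its column and row ℓ + 2 does not.
FirstRowArmLeg : ℕ → ℕ → List ℕ → Set
FirstRowArmLeg a ℓ xs = shortfall ℓ xs ≤ a × a < shortfall (suc ℓ) xs

armLeg-unique : ∀ {a ℓ ℓ′ xs} → NonIncreasing xs →
  FirstRowArmLeg a ℓ xs → FirstRowArmLeg a ℓ′ xs → ℓ ≡ ℓ′
armLeg-unique {a} {ℓ} {ℓ′} {xs} ni (lo , hi) (lo′ , hi′) with <-cmp ℓ ℓ′
... | tri≈ _ ℓ≡ℓ′ _ = ℓ≡ℓ′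
... | tri< ℓ<ℓ′ _ _ = ⊥-elim (<⇒≱ hi (≤-trans (shortfall-mono xs ni ℓ<ℓ′) lo′))
... | tri> _ _ ℓ′<ℓ = ⊥-elim (<⇒≱ hi′ (≤-trans (shortfall-mono xs ni ℓ′<ℓ) lo))

box-armLeg : ∀ {r j} rs → NonIncreasing (r ∷ rs) → j < r →
  FirstRowArmLeg (arm r j) (leg j rs) (r ∷ rs)
box-armLeg {r} {j} rs ni j<r = lo , hi
  where
  ℓ = leg j rs
  bounds = leg-bounds rs ni j<r
  lo : shortfall ℓ (r ∷ rs) ≤ arm r j
  lo = subst (shortfall ℓ (r ∷ rs) ≤_) (sym (arm≡ r j)) (∸-monoʳ-≤ r (proj₂ bounds))
  hi : arm r j < shortfall (suc ℓ) (r ∷ rs)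
  hi = subst (_< shortfall (suc ℓ) (r ∷ rs)) (sym (arm≡ r j)) (∸-monoʳ-< (s≤s (proj₁ bounds)) j<r)

∈-firstRowHooks⁻ : ∀ {r rs k} → NonIncreasing (r ∷ rs) → k ∈ firstRowHooks r rs →
  ∃₂ λ a ℓ → suc (a + ℓ) ≡ k × FirstRowArmLeg a ℓ (r ∷ rs)
∈-firstRowHooks⁻ {r} {rs} ni k∈ with ∈-map⁻ (hookLength r rs) k∈
... | j , j∈ , refl =
  arm r j , leg j rs , +-comm 1 (arm r j + leg j rs) , box-armLeg rs ni (∈-upTo⁻ j∈)

∈-firstRowHooks⁺ : ∀ {r rs a ℓ} → NonIncreasing (r ∷ rs) → FirstRowArmLeg a ℓ (r ∷ rs) →
  suc (a + ℓ) ∈ firstRowHooks r rs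
∈-firstRowHooks⁺ {r} {rs} {a} {ℓ} ni armLeg =
  subst (_∈ firstRowHooks r rs) hook≡ (∈-map⁺ _ (∈-upTo⁺ j<r))
  where
  a<r : a < r
  a<r = <-≤-trans (proj₂ armLeg) (m∸n≤m r (part (suc ℓ) (r ∷ rs)))
  j = r ∸ suc a
  j<r : j < r
  j<r = ∸-monoʳ-< z<s a<r
  arm-j : arm r j ≡ a
  arm-j = cong (_∸ 1) (m∸[m∸n]≡n a<r)
  leg-j : leg j rs ≡ ℓ
  leg-j = armLeg-unique ni (subst (λ x → FirstRowArmLeg x (leg j rs) (r ∷ rs)) arm-j
    (box-armLeg rs ni j<r)) armLeg
  hook≡ : arm r j + leg j rs + 1 ≡ suc (a + ℓ)
  hook≡ = trans (cong₂ (λ x y → x + y + 1) arm-j leg-j) (+-comm (a + ℓ) 1)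

numHooks-∷ : ∀ k r rs →
  numHooks k (r ∷ rs) ≡ countB (_≡ᵇ k) (firstRowHooks r rs) + numHooks k rs
numHooks-∷ k r rs = countB-++ (_≡ᵇ k) (firstRowHooks r rs) (hooks rs)

isCore-∷ : ∀ t .{{_ : NonZero t}} r rs → T (isCore t (r ∷ rs)) →
  All (λ h → T (not (h % t ≡ᵇ 0))) (firstRowHooks r rs) × T (isCore t rs)
isCore-∷ t r rs core with ++⁻ (firstRowHooks r rs) (allB⇒All _ (hooks (r ∷ rs)) core)
... | firstRow , rest = firstRow , All⇒allB rest

inRange? : ℕ → ℕ → ℕ → Bool
inRange? a lo hi = (lo ≤ᵇ a) ∧ (a <ᵇ hi)

inRange?-sound : ∀ a lo hi → T (inRange? a lo hi) → lo ≤ a × a < hi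
inRange?-sound a lo hi t = ≤ᵇ⇒≤ lo a (proj₁ (to T-∧ t)) , <ᵇ⇒< a hi (proj₂ (to T-∧ t))

inRange?-complete : ∀ {a lo hi} → lo ≤ a → a < hi → T (inRange? a lo hi)
inRange?-complete lo≤a a<hi = from T-∧ (≤⇒≤ᵇ lo≤a , <⇒<ᵇ a<hi)

-- Functions of the gaps d₀, d₁, d₂: inRange? a (d₀ + ⋯ + d_{ℓ−1}) (d₀ + ⋯ + d_ℓ) holds iff
-- the first row has a box with arm a and leg ℓ.
threeHookShapes : ℕ → ℕ → ℕ → ℕ
threeHookShapes d₀ d₁ d₂ =
  𝟙[ inRange? 2 0 d₀ ] + 𝟙[ inRange? 1 d₀ (d₀ + d₁) ] + 𝟙[ inRange? 0 (d₀ + d₁) (d₀ + (d₁ + d₂)) ]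

FourHookFree : ℕ → ℕ → ℕ → Set
FourHookFree d₀ d₁ d₂ =
  ¬ T (inRange? 3 0 d₀) × ¬ T (inRange? 2 d₀ (d₀ + d₁)) ×
  ¬ T (inRange? 1 (d₀ + d₁) (d₀ + (d₁ + d₂)))

-- In a 4-core, 1 exactly when the 1-hook at the first nonzero gap is not yet paired with a
-- 3-hook of the rows from here down.
potential : ℕ → ℕ → ℕ
potential d₀ d₁ = 𝟙[ (d₀ ≡ᵇ 2) ∨ (d₀ + d₁ ≡ᵇ 1) ]

potential-step : ∀ d₀ d₁ d₂ → FourHookFree d₀ d₁ d₂ →
  potential d₀ d₁ + threeHookShapes d₀ d₁ d₂ ≤ 𝟙[ 0 <ᵇ d₀ ] + potential d₁ d₂
potential-step 0 0 0 _ = z≤n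
potential-step 0 0 1 _ = ≤-refl
potential-step 0 0 (suc (suc _)) (_ , _ , no₁₂) = ⊥-elim (no₁₂ tt)
potential-step 0 1 0 _ = ≤-refl
potential-step 0 1 (suc _) (_ , _ , no₁₂) = ⊥-elim (no₁₂ tt)
potential-step 0 2 _ _ = ≤-refl
potential-step 0 (suc (suc (suc _))) _ (_ , no₂₁ , _) = ⊥-elim (no₂₁ tt)
potential-step 1 0 0 _ = ≤-refl
potential-step 1 0 (suc _) (_ , _ , no₁₂) = ⊥-elim (no₁₂ tt)
potential-step 1 1 _ _ = s≤s z≤n
potential-step 1 (suc (suc _)) _ (_ , no₂₁ , _) = ⊥-elim (no₂₁ tt)
potential-step 2 0 _ _ = s≤s z≤n
potential-step 2 (suc _) _ (_ , no₂₁ , _) = ⊥-elim (no₂₁ tt)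
potential-step 3 _ _ _ = s≤s z≤n
potential-step (suc (suc (suc (suc _)))) _ _ (no₃₀ , _) = ⊥-elim (no₃₀ tt)

module FirstRow {r rs} (ni : NonIncreasing (r ∷ rs)) where

  private
    xs = r ∷ rs
    d₀ = gap 0 xs
    d₁ = gap 1 xs
    d₂ = gap 2 xs

    shortfall₀ : shortfall 0 xs ≡ 0
    shortfall₀ = n∸n≡0 r

    shortfall₂ : shortfall 2 xs ≡ d₀ + d₁
    shortfall₂ = part-∸-split xs ni z≤n (s≤s z≤n)

    shortfall₃ : shortfall 3 xs ≡ d₀ + (d₁ + d₂)
    shortfall₃ = trans (part-∸-split xs ni z≤n (s≤s z≤n))
      (cong (d₀ +_) (part-∸-split xs ni (s≤s z≤n) (s≤s (s≤s z≤n))))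

  oneHook : 𝟙[ 0 <ᵇ d₀ ] ≤ countB (_≡ᵇ 1) (firstRowHooks r rs)
  oneHook = 𝟙-≤ λ 0<d₀ →
    ∈⇒1≤countB (_≡ᵇ 1) (∈-firstRowHooks⁺ ni (≤-reflexive shortfall₀ , <ᵇ⇒< 0 d₀ 0<d₀)) tt

  threeHooks : countB (_≡ᵇ 3) (firstRowHooks r rs) ≤ threeHookShapes d₀ d₁ d₂
  threeHooks = ≤1-pos⇒≤ (countB-unique (firstRowHooks-unique r rs)) λ pos →
    let k , k∈ , k≡3 = 1≤countB⇒∈ (_≡ᵇ 3) (firstRowHooks r rs) pos
        a , ℓ , hook≡k , armLeg = ∈-firstRowHooks⁻ ni k∈
    in 𝟙-pos₃ (inRange? 2 0 d₀) (inRange? 1 d₀ (d₀ + d₁)) (inRange? 0 (d₀ + d₁) (d₀ + (d₁ + d₂)))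
         (shape (trans hook≡k (≡ᵇ⇒≡ k 3 k≡3)) armLeg)
    where
    shape : ∀ {a ℓ} → suc (a + ℓ) ≡ 3 → FirstRowArmLeg a ℓ xs →
      T (inRange? 2 0 d₀) ⊎ T (inRange? 1 d₀ (d₀ + d₁)) ⊎ T (inRange? 0 (d₀ + d₁) (d₀ + (d₁ + d₂)))
    shape {2} refl (_ , 2<d₀) = inj₁ (<⇒<ᵇ 2<d₀)
    shape {1} refl (d₀≤1 , 1<D₂) =
      inj₂ (inj₁ (inRange?-complete d₀≤1 (subst (1 <_) shortfall₂ 1<D₂)))
    shape {0} refl (D₂≤0 , 0<D₃) =
      inj₂ (inj₂ (inRange?-complete (subst (_≤ 0) shortfall₂ D₂≤0) (subst (0 <_) shortfall₃ 0<D₃)))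
    shape {suc (suc (suc _))} ()

  noFourHook : T (isCore 4 xs) → FourHookFree d₀ d₁ d₂
  noFourHook core = no₃₀ , no₂₁ , no₁₂
    where
    excluded : ∀ a ℓ → FirstRowArmLeg a ℓ xs → T (not (suc (a + ℓ) % 4 ≡ᵇ 0))
    excluded a ℓ armLeg = All.lookup (proj₁ (isCore-∷ 4 r rs core)) (∈-firstRowHooks⁺ ni armLeg)
    no₃₀ : ¬ T (inRange? 3 0 d₀)
    no₃₀ t = excluded 3 0 (subst (_≤ 3) (sym shortfall₀) z≤n , proj₂ (inRange?-sound 3 0 d₀ t))
    no₂₁ : ¬ T (inRange? 2 d₀ (d₀ + d₁))
    no₂₁ t with inRange?-sound 2 d₀ (d₀ + d₁) t
    ... | d₀≤2 , 2<D₂ = excluded 2 1 (d₀≤2 , subst (2 <_) (sym shortfall₂) 2<D₂)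
    no₁₂ : ¬ T (inRange? 1 (d₀ + d₁) (d₀ + (d₁ + d₂)))
    no₁₂ t with inRange?-sound 1 (d₀ + d₁) (d₀ + (d₁ + d₂)) t
    ... | D₂≤1 , 1<D₃ =
      excluded 1 2 (subst (_≤ 1) (sym shortfall₂) D₂≤1 , subst (1 <_) (sym shortfall₃) 1<D₃)

potential-invariant : ∀ xs → NonIncreasing xs → T (isCore 4 xs) →
  potential (gap 0 xs) (gap 1 xs) + numHooks 3 xs ≤ numHooks 1 xs
potential-invariant [] _ _ = z≤n
potential-invariant (r ∷ rs) ni core = begin
  P + numHooks 3 (r ∷ rs)  ≡⟨ cong (P +_) (numHooks-∷ 3 r rs) ⟩
  P + (c₃ + n₃)            ≡⟨ sym (+-assoc P c₃ n₃) ⟩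
  P + c₃ + n₃              ≤⟨ +-monoˡ-≤ n₃ (+-monoʳ-≤ P threeHooks) ⟩
  P + shapes + n₃          ≤⟨ +-monoˡ-≤ n₃ (potential-step d₀ d₁ d₂ (noFourHook core)) ⟩
  𝟙[ 0 <ᵇ d₀ ] + P′ + n₃   ≡⟨ +-assoc 𝟙[ 0 <ᵇ d₀ ] P′ n₃ ⟩
  𝟙[ 0 <ᵇ d₀ ] + (P′ + n₃) ≤⟨ +-mono-≤ oneHook rest ⟩
  c₁ + numHooks 1 rs       ≡⟨ sym (numHooks-∷ 1 r rs) ⟩
  numHooks 1 (r ∷ rs)      ∎
  where
  open ≤-Reasoning
  open FirstRow ni
  d₀ = gap 0 (r ∷ rs)
  d₁ = gap 1 (r ∷ rs)
  d₂ = gap 2 (r ∷ rs)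
  P = potential d₀ d₁
  P′ = potential d₁ d₂
  shapes = threeHookShapes d₀ d₁ d₂
  c₁ = countB (_≡ᵇ 1) (firstRowHooks r rs)
  c₃ = countB (_≡ᵇ 3) (firstRowHooks r rs)
  n₃ = numHooks 3 rs
  rest : P′ + n₃ ≤ numHooks 1 rs
  rest = potential-invariant rs (Linked.tail ni) (proj₂ (isCore-∷ 4 r rs core))

fourCore-threeHooks≤oneHooks : ∀ xs → NonIncreasing xs → T (isCore 4 xs) →
  numHooks 3 xs ≤ numHooks 1 xs
fourCore-threeHooks≤oneHooks xs ni core = ≤-trans (m≤n+m _ _) (potential-invariant xs ni core)

theorem1p4 : (n : ℕ) → a 4 1 n ≥ a 4 3 n
theorem1p4 n = sum-map-mono (filter (λ xs → T? (isCore 4 xs)) (partitions n)) λ {xs} xs∈ →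
  let xs∈partitions , core = ∈-filter⁻ (λ ys → T? (isCore 4 ys)) {xs = partitions n} xs∈
      _ , isPartition = ∈-filter⁻ (λ ys → T? (isPartitionOf n ys)) {xs = allLists n} xs∈partitions
  in fourCore-threeHooks≤oneHooks xs (isPartitionOf⇒NonIncreasing xs isPartition) core
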